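{- Let $(C,\alpha)$ be a $\mathcal{T}$-coalgebra and $c\in C$. For any distinct $r,s\in\mathrm{Roots}(\alpha,c)$, $(\mathrm{word}(r)\circ\mathrm{pnodes}(\mathrm{frag}^\alpha(c,r)))\cap(\mathrm{word}(s)\circ\mathrm{pnodes}(\mathrm{frag}^\alpha(c,s)))=\varnothing$.
   Context: Words are finite sequences of natural numbers; $\epsilon$ the empty word, $\mathbb{N}^+$ the nonempty words; concatenation is juxtaposition; for a set $W$ of words, $w\circ W=\{wv: v\in W\}$. Finite sequences of elements of $\mathbb{N}^+$ are denoted $r,s$; $\mathsf{nil}$ is the empty sequence, $w{:}r$ prepends $w$. A tree is a prefix-closed set of words with a labelling, finitely branching. Fix a set $A$ and $*\notin A$. A finite tree with non-wellfounded leaves is a finite tree $\iota$ labelled in $A\cup\{*\}$ whose root is not labelled $*$ and whose $*$-labelled nodes are leaves; $\mathrm{nwleaf}(\iota)$ is its set of $*$-labelled nodes and $\mathrm{pnodes}(\iota)$ the remaining nodes; $\mathrm{NWT}$ the set of such trees. $\mathcal{T}(X)=\{(\iota,\mu):\iota\in\mathrm{NWT},\ \mu:\mathrm{nwleaf}(\iota)\to X\}$, $\mathcal{T}(f)(\iota,\mu)=(\iota,f\circ\mu)$. A coalgebra is $(C,\alpha)$, $\alpha:C\to\mathcal{T}(C)$, $\alpha(c)=(\iota^\alpha_c,\mu^\alpha_c)$. Root-paths: $\mathsf{nil}\in\mathrm{Roots}(\alpha,c)$; $w{:}r\in\mathrm{Roots}(\alpha,c)$ iff $w\in\mathrm{nwleaf}(\iota^\alpha_c)$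 and $r\in\mathrm{Roots}(\alpha,\mu^\alpha_c(w))$. Fragment: $\mathrm{frag}^\alpha(c,\mathsf{nil})=\iota^\alpha_c$, $\mathrm{frag}^\alpha(c,w{:}r)=\mathrm{frag}^\alpha(\mu^\alpha_c(w),r)$. $\mathrm{word}(\mathsf{nil})=\epsilon$, $\mathrm{word}(w{:}r)=w\,\mathrm{word}(r)$. -}

module Defs where

open import Data.Nat using (ℕ)
open import Data.List using (List; []; _∷_; _++_; [_]; concat)
open import Data.List.Membership.Propositional using (_∈_; _∉_)
open import Data.Maybe using (Maybe; just; nothing)
open import Data.Product using (Σ; ∃; _×_)
open import Relation.Binary.PropositionalEquality using (_≡_; _≢_)

Word : Set
Word = List ℕ

-- Label of a node: just a  (a ∈ A)  or  nothing  (the extra symbol *).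
record NWT (A : Set) : Set where
  field
    nodes         : List Word
    root-node     : [] ∈ nodes
    prefix-closed : ∀ (w v : Word) → (w ++ v) ∈ nodes → w ∈ nodes
    label         : Word → Maybe A
    root-not-star : label [] ≢ nothing
    star-leaf     : ∀ (w : Word) → w ∈ nodes → label w ≡ nothing →
                    ∀ (i : ℕ) → (w ++ [ i ]) ∉ nodes
open NWT public

nwleaf : {A : Set} → NWT A → Word → Set
nwleaf ι w = (w ∈ nodes ι) × (label ι w ≡ nothing)

pnodes : {A : Set} → NWT A → Word → Set
pnodes {A} ι w = (w ∈ nodes ι) × (Σ A (λ a → label ι w ≡ just a))

-- 𝒯(X) = {(ι, μ) : ι ∈ NWT, μ : nwleaf(ι) → X}.  μ is represented as a
-- total function on words; only its values on nwleaf(ι) are ever used.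
𝒯 : (A : Set) → Set → Set
𝒯 A X = Σ (NWT A) (λ ι → Word → X)

Coalgebra : (A : Set) → Set → Set
Coalgebra A C = C → 𝒯 A C

ιᵅ : {A C : Set} → Coalgebra A C → C → NWT A
ιᵅ α c = Data.Product.proj₁ (α c)

μᵅ : {A C : Set} → Coalgebra A C → C → Word → C
μᵅ α c = Data.Product.proj₂ (α c)

-- Root-paths (sequences of nonempty words; elements of nwleaf are nonempty
-- automatically since the root is not *-labelled).
data Roots {A C : Set} (α : Coalgebra A C) : C → List Word → Set where
  nil  : ∀ {c} → Roots α c []
  cons : ∀ {c w r} → nwleaf (ιᵅ α c) w → Roots α (μᵅ α c w) r → Roots α c (w ∷ r)

frag : {A C : Set} → Coalgebra A C → C → List Word → NWT A
frag α c []      = ιᵅ α c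
frag α c (w ∷ r) = frag α (μᵅ α c w) r

word : List Word → Word
word r = concat r

_∘ʷ_ : Word → (Word → Set) → Word → Set
(w ∘ʷ W) u = ∃ λ v → W v × (u ≡ w ++ v)

-- A *-leaf of a fragment has no proper extension inside the fragment, so two *-leaves of
-- one fragment that are prefixes of a common word coincide, and no *-leaf is a prefix of a
-- proper node. If u is a placed proper node for two root-paths, their first steps are
-- therefore equal and can be cancelled from u; inducting, either the paths are equal or
-- one ends while the other continues through a *-leaf w, making u a proper node above w.
{-# OPTIONS --safe #-}
module Submission where

open import Defs
open import Data.List using (List; []; _∷_; _++_; [_])
open import Data.List.Properties using (++-assoc; ++-identityʳ; ++-cancelˡ; ∷-injectiveˡ; ∷-injectiveʳ)
open import Data.List.Membership.Propositional using (_∈_)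
open import Data.Product using (_×_; _,_; ∃-syntax)
open import Data.Sum using (_⊎_; inj₁; inj₂)
open import Data.Empty using (⊥-elim)
open import Function using (_∘_)
open import Relation.Nullary using (¬_)
open import Relation.Binary.PropositionalEquality using (_≡_; _≢_; refl; sym; trans; cong; subst)

++-prefix-comparable : ∀ {w w' a b : Word} → w ++ a ≡ w' ++ b →
  (∃[ y ] w ≡ w' ++ y) ⊎ (∃[ y ] w' ≡ w ++ y)
++-prefix-comparable {[]}    {w'}     _ = inj₂ (w' , refl)
++-prefix-comparable {i ∷ w} {[]}     _ = inj₁ (i ∷ w , refl)
++-prefix-comparable {i ∷ w} {j ∷ w'} e with ∷-injectiveˡ e
... | refl with ++-prefix-comparable {w} {w'} (∷-injectiveʳ e)
...   | inj₁ (y , w≡w'y) = inj₁ (y , cong (i ∷_) w≡w'y)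
...   | inj₂ (y , w'≡wy) = inj₂ (y , cong (i ∷_) w'≡wy)

∘ʷ-++⁻ : ∀ {P : Word → Set} (w v : Word) {u : Word} →
  ((w ++ v) ∘ʷ P) u → ∃[ x ] u ≡ w ++ x × (v ∘ʷ P) x
∘ʷ-++⁻ w v (y , Py , u≡wvy) = v ++ y , trans u≡wvy (++-assoc w v y) , y , Py , refl

module _ {A : Set} (ι : NWT A) where

  nwleaf-maximal : ∀ {w x : Word} → nwleaf ι w → (w ++ x) ∈ nodes ι → x ≡ []
  nwleaf-maximal {w} {[]}    _              _     = refl
  nwleaf-maximal {w} {i ∷ x} (w∈ι , w-star) wix∈ι =
    ⊥-elim (star-leaf ι w w∈ι w-star i
      (prefix-closed ι (w ++ [ i ]) x (subst (_∈ nodes ι) (sym (++-assoc w [ i ] x)) wix∈ι)))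

  nwleaf-extension-≡ : ∀ {w x : Word} → nwleaf ι w → (w ++ x) ∈ nodes ι → w ++ x ≡ w
  nwleaf-extension-≡ {w} w-leaf wx∈ι =
    trans (cong (w ++_) (nwleaf-maximal w-leaf wx∈ι)) (++-identityʳ w)

  nwleaf-¬pnodes : ∀ {w : Word} → nwleaf ι w → ¬ pnodes ι w
  nwleaf-¬pnodes (_ , w-star) (_ , _ , w-labelled) with trans (sym w-labelled) w-star
  ... | ()

  nwleaf-extension-¬pnodes : ∀ {w x : Word} → nwleaf ι w → ¬ pnodes ι (w ++ x)
  nwleaf-extension-¬pnodes w-leaf wx-pnode@(wx∈ι , _) =
    nwleaf-¬pnodes w-leaf (subst (pnodes ι) (nwleaf-extension-≡ w-leaf wx∈ι) wx-pnode)

  nwleaf-prefix-unique : ∀ {w w' a b : Word} → nwleaf ι w → nwleaf ι w' →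
    w ++ a ≡ w' ++ b → w ≡ w'
  nwleaf-prefix-unique w-leaf@(w∈ι , _) w'-leaf@(w'∈ι , _) e with ++-prefix-comparable e
  ... | inj₁ (y , w≡w'y) =
    trans w≡w'y (nwleaf-extension-≡ w'-leaf (subst (_∈ nodes ι) w≡w'y w∈ι))
  ... | inj₂ (y , w'≡wy) =
    sym (trans w'≡wy (nwleaf-extension-≡ w-leaf (subst (_∈ nodes ι) w'≡wy w'∈ι)))

module _ {A C : Set} (α : Coalgebra A C) where

  placed-pnodes-disjoint : ∀ {c r s} → Roots α c r → Roots α c s → r ≢ s → ∀ {u} →
    (word r ∘ʷ pnodes (frag α c r)) u → ¬ (word s ∘ʷ pnodes (frag α c s)) u
  placed-pnodes-disjoint nil nil r≢s _ _ = r≢s refl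
  placed-pnodes-disjoint {c} nil (cons {w = w} {r = s} w-leaf _) _ (_ , u-pnode , refl) q
    with ∘ʷ-++⁻ w (word s) q
  ... | _ , refl , _ = nwleaf-extension-¬pnodes (ιᵅ α c) w-leaf u-pnode
  placed-pnodes-disjoint {c} (cons {w = w} {r = r} w-leaf _) nil _ p (_ , u-pnode , refl)
    with ∘ʷ-++⁻ w (word r) p
  ... | _ , refl , _ = nwleaf-extension-¬pnodes (ιᵅ α c) w-leaf u-pnode
  placed-pnodes-disjoint {c} (cons {w = w} {r = r} w-leaf r-roots)
                             (cons {w = w'} {r = s} w'-leaf s-roots) w∷r≢w'∷s p q
    with ∘ʷ-++⁻ w (word r) p | ∘ʷ-++⁻ w' (word s) q
  ... | x , refl , p' | x' , wx≡w'x' , q'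
    with refl ← nwleaf-prefix-unique (ιᵅ α c) w-leaf w'-leaf wx≡w'x'
    with refl ← ++-cancelˡ w x x' wx≡w'x'
    = placed-pnodes-disjoint r-roots s-roots (w∷r≢w'∷s ∘ cong (w ∷_)) p' q'

lemma2p18 : (A C : Set) (α : Coalgebra A C) (c : C) (r s : List Word) →
    Roots α c r → Roots α c s → r ≢ s →
    ∀ (u : Word) → ¬ ((word r ∘ʷ pnodes (frag α c r)) u × (word s ∘ʷ pnodes (frag α c s)) u)
lemma2p18 A C α c r s r-roots s-roots r≢s u (p , q) = placed-pnodes-disjoint α r-roots s-roots r≢s p q
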